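{- Let $G$ be a finite simple graph and $T$ its toll walk transit function. Then $T$ satisfies Axioms (dh) and (dh1) on $G$ if and only if $G$ is a distance-hereditary graph.
   Context: In a finite simple graph $G$, a walk $W=w_1w_2\cdots w_k$ ($k\ge 2$) is a toll walk if $w_1\neq w_k$, $w_2$ is the only neighbor of $w_1$ among the vertices of $W$, and $w_{k-1}$ is the only neighbor of $w_k$ among the vertices of $W$. The toll walk transit function $T$ of $G$ is given by $T(u,u)=\{u\}$ and, for $u\ne v$, $T(u,v)$ is the set of all vertices lying on some toll walk from $u$ to $v$. A graph is distance-hereditary if every induced path is a shortest path. Axioms for $R=T$ on $V=V(G)$: (dh) For pairwise distinct $u,x,y,v,z$: if $x,y,z\in R(u,y)\cap R(x,v)$, $R(u,v)\neq\{u,v\}$, $R(x,y)=\{x,y\}$, $R(u,z)=\{u,z\}$ and $R(v,z)=\{v,z\}$, then $R(x,z)\neq\{x,z\}$ or $R(y,z)\neq\{y,z\}$. (dh1) For all $u,x,y,v$: if $x\in R(u,y)$, $y\in R(x,v)$, $R(x,y)=\{x,y\}$, $x\neq y$, $R(u,x)\neq\{u,x\}$ and $R(y,v)\neq\{y,v\}$, then $x\in R(u,v)$. -}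

module Defs where

open import Data.Nat using (ℕ; suc; _≤_; _<_)
open import Data.Fin using (Fin; toℕ)
open import Data.List using (List; []; _∷_; _++_; length; lookup)
open import Data.List.Membership.Propositional using (_∈_)
open import Data.List.Relation.Unary.Unique.Propositional using (Unique)
open import Data.Product using (Σ; ∃; ∃-syntax; _×_; _,_)
open import Data.Sum using (_⊎_)
open import Data.Unit using (⊤)
open import Relation.Nullary using (¬_; Dec)
open import Relation.Binary.PropositionalEquality using (_≡_; _≢_)

record Graph (n : ℕ) : Set₁ where
  field
    _~_    : Fin n → Fin n → Set
    ~-sym  : ∀ {x y} → x ~ y → y ~ x
    ~-irr  : ∀ {x} → ¬ (x ~ x)
    ~-dec  : ∀ x y → Dec (x ~ y)

module _ {n : ℕ} (G : Graph n) where
  open Graph G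

  V : Set
  V = Fin n

  Chain : List V → Set
  Chain []            = ⊤
  Chain (x ∷ [])      = ⊤
  Chain (x ∷ y ∷ ws)  = (x ~ y) × Chain (y ∷ ws)

  Ends : V → V → List V → Set
  Ends a b W = (∃[ rest ] W ≡ a ∷ rest) × (∃[ init ] W ≡ init ++ b ∷ [])

  -- toll walk from u to v (k ≥ 2 is forced by the two decompositions)
  TollWalk : V → V → List V → Set
  TollWalk u v W =
    u ≢ v × Chain W
    × (∃[ a ] ∃[ rest ] (W ≡ u ∷ a ∷ rest × (∀ x → x ∈ W → u ~ x → x ≡ a)))
    × (∃[ b ] ∃[ init ] (W ≡ init ++ b ∷ v ∷ [] × (∀ x → x ∈ W → v ~ x → x ≡ b)))

  T : V → V → V → Set
  T u v x = (u ≡ v × x ≡ u) ⊎ (∃[ W ] (TollWalk u v W × x ∈ W))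

  IsPair : V → V → Set
  IsPair u v = ∀ x → (T u v x → (x ≡ u ⊎ x ≡ v)) × ((x ≡ u ⊎ x ≡ v) → T u v x)

  -- Axiom (dh); the conclusion "T(x,z) ≠ {x,z} or T(y,z) ≠ {y,z}"
  -- is rendered as ¬ (T(x,z) = {x,z} and T(y,z) = {y,z}).
  AxiomDH : Set
  AxiomDH = ∀ u x y v z →
    Unique (u ∷ x ∷ y ∷ v ∷ z ∷ []) →
    (T u y x × T x v x) → (T u y y × T x v y) → (T u y z × T x v z) →
    ¬ IsPair u v → IsPair x y → IsPair u z → IsPair v z →
    ¬ (IsPair x z × IsPair y z)

  AxiomDH1 : Set
  AxiomDH1 = ∀ u x y v →
    T u y x → T x v y → IsPair x y → x ≢ y →
    ¬ IsPair u x → ¬ IsPair y v → T u v x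

  InducedPath : List V → Set
  InducedPath P =
    Unique P × Chain P ×
    (∀ (i j : Fin (length P)) → suc (toℕ i) < toℕ j → ¬ (lookup P i ~ lookup P j))

  DistanceHereditary : Set
  DistanceHereditary = ∀ a b P → InducedPath P → Ends a b P →
    ∀ Q → Chain Q → Ends a b Q → length P ≤ length Q

-- In a distance-hereditary graph every induced path is a geodesic, so on a toll walk from s to t the
-- only neighbour of t is one step closer to s.  For (dh) this makes u x y v an induced path between
-- vertices at distance two (through z).  For (dh1) it shows that u sees no vertex of the toll walk
-- from x to v and v none of the toll walk from u to y, so that u ⋯ x y ⋯ v is a toll walk through x.
--
-- Conversely, take an induced path P = t x y ⋯ s and a shorter walk Q = t w ⋯ s with |P| + |Q|
-- minimal; Q may be taken induced.  Minimality and (dh1) with u = v = s force w ~ x, and then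
-- minimality forces w ~ s and |P| = 4.  Now w is adjacent to t, x and s, and t x y s is induced:
-- if w ~ y this is a gem, excluded by (dh); otherwise y s w t is an induced path and (dh1) with
-- u = v = t is violated.

module Submission where

open import Defs
open import Data.Nat using (ℕ; zero; suc; _+_; _≤_; _<_; z≤n; s≤s; s≤s⁻¹)
open import Data.Nat.Properties
  using ( ≤-refl; ≤-trans; <-≤-trans; <-irrefl; <-asym; <⇒≱; ≰⇒>; _≤?_; n≮0; n≤1+n
        ; +-monoʳ-≤; +-mono-<-≤; +-mono-≤-<)
open import Data.Fin using (Fin; toℕ) renaming (zero to fzero; suc to fsuc)
open import Data.Fin.Properties using (_≟_)
open import Data.List using (List; []; _∷_; _++_; _∷ʳ_; length; lookup; reverse)
open import Data.List.Properties using (∷-injectiveʳ; ++-assoc; length-++-≤ʳ; unfold-reverse)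
open import Data.List.Membership.Propositional using (_∈_; _∉_; lose)
open import Data.List.Membership.Propositional.Properties
  using (∈-++⁺ˡ; ∈-++⁺ʳ; ∈-++⁻; ∈-∃++; ∈-lookup)
open import Data.List.Relation.Binary.Subset.Propositional using (_⊆_)
open import Data.List.Relation.Unary.Any using (Any; here; there; any?; index)
open import Data.List.Relation.Unary.Any.Properties using (lookup-index; reverse⁺; reverse⁻)
open import Data.List.Relation.Unary.All using (All; []; _∷_; tabulate) renaming (lookup to All-lookup)
open import Data.List.Relation.Unary.All.Properties using (¬Any⇒All¬; All¬⇒¬Any; ++⁻ˡ)
open import Data.List.Relation.Unary.AllPairs using ([]; _∷_)
open import Data.List.Relation.Unary.Unique.Propositional using (Unique)
open import Data.Product using (∃-syntax; _×_; _,_; proj₁; proj₂)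
open import Data.Sum using (_⊎_; inj₁; inj₂)
open import Data.Unit using (⊤; tt)
open import Data.Empty using (⊥; ⊥-elim)
open import Relation.Nullary using (¬_; Dec; yes; no)
open import Relation.Nullary.Decidable using (decidable-stable)
open import Relation.Binary.PropositionalEquality using (_≡_; _≢_; ≢-sym; refl; sym; trans; cong; subst)
open import Function.Base using (case_of_)
open import Function.Bundles using (_⇔_; mk⇔)

module _ {n : ℕ} (G : Graph n) where
  open Graph G

  private variable
    a b c d r s t u v w x y z : V G
    A B L W P Q : List (V G)

  ~⇒≢ : x ~ y → x ≢ y
  ~⇒≢ h refl = ~-irr h

  ∉⇒≢ : x ∉ L → y ∈ L → x ≢ y
  ∉⇒≢ x∉ y∈ refl = x∉ y∈

  -- Walks

  data Walk : V G → V G → List (V G) → Set where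
    stop : ∀ x → Walk x x (x ∷ [])
    cons : x ~ y → Walk y t (y ∷ L) → Walk x t (x ∷ y ∷ L)

  _◅_ : x ~ y → Walk y t L → Walk x t (x ∷ L)
  h ◅ stop _     = cons h (stop _)
  h ◅ cons h′ w′ = cons h (cons h′ w′)

  _⊙_ : Walk s x W → Walk x t (x ∷ L) → Walk s t (W ++ L)
  stop _     ⊙ w′ = w′
  cons h w   ⊙ w′ = cons h (w ⊙ w′)

  start∈ : Walk s t W → s ∈ W
  start∈ (stop _)   = here refl
  start∈ (cons _ _) = here refl

  end∈ : Walk s t W → t ∈ W
  end∈ (stop _)   = here refl
  end∈ (cons _ w) = there (end∈ w)

  walk-edge : Walk s t (s ∷ x ∷ L) → s ~ x
  walk-edge (cons h _) = h

  walk-tail : Walk s t (s ∷ x ∷ L) → Walk x t (x ∷ L)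
  walk-tail (cons _ w) = w

  walk-snoc : Walk s t W → t ~ u → Walk s u (W ∷ʳ u)
  walk-snoc (stop _)   h = cons h (stop _)
  walk-snoc (cons h w) h′ = cons h (walk-snoc w h′)

  walk-reverse : Walk s t W → Walk t s (reverse W)
  walk-reverse (stop x) = stop x
  walk-reverse {W = x ∷ L} (cons h w) =
    subst (Walk _ _) (sym (unfold-reverse x L)) (walk-snoc (walk-reverse w) (~-sym h))

  walk-suffix : ∀ A → Walk s t (A ++ z ∷ B) → Walk z t (z ∷ B)
  walk-suffix []          (stop _)   = stop _
  walk-suffix []          (cons h w) = cons h w
  walk-suffix (_ ∷ [])    (cons _ w) = w
  walk-suffix (_ ∷ _ ∷ A) (cons _ w) = walk-suffix (_ ∷ A) w

  walk-prefix : ∀ A → Walk s t (A ++ z ∷ B) → Walk s z (A ∷ʳ z)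
  walk-prefix []          (stop _)   = stop _
  walk-prefix []          (cons _ _) = stop _
  walk-prefix (_ ∷ [])    (cons h w) = cons h (walk-prefix [] w)
  walk-prefix (_ ∷ _ ∷ A) (cons h w) = cons h (walk-prefix (_ ∷ A) w)

  walk-from : z ∈ W → Walk s t W → ∃[ W′ ] (Walk z t W′ × length W′ ≤ length W)
  walk-from {z} z∈ w with ∈-∃++ z∈
  ... | A , B , refl = z ∷ B , walk-suffix A w , length-++-≤ʳ (z ∷ B) {A}

  walk-to : z ∈ W → Walk s t W → ∃[ W′ ] (Walk s z W′ × W′ ⊆ W)
  walk-to {z} z∈ w with ∈-∃++ z∈
  ... | A , B , refl = A ∷ʳ z , walk-prefix A w , ⊆-prefix
    where
      ⊆-prefix : A ∷ʳ z ⊆ A ++ z ∷ B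
      ⊆-prefix p with ∈-++⁻ A p
      ... | inj₁ q         = ∈-++⁺ˡ q
      ... | inj₂ (here eq) = ∈-++⁺ʳ A (here eq)

  walk-end-unique : ∀ A → Walk s t (A ∷ʳ z) → z ≡ t
  walk-end-unique []          (stop _)   = refl
  walk-end-unique (_ ∷ [])    (cons _ w) = walk-end-unique [] w
  walk-end-unique (_ ∷ _ ∷ A) (cons _ w) = walk-end-unique (_ ∷ A) w

  length-∷ʳ : ∀ L → length (L ∷ʳ x) ≡ suc (length L)
  length-∷ʳ []      = refl
  length-∷ʳ (_ ∷ L) = cong suc (length-∷ʳ L)

  walk-second : Walk s t W → s ≢ t → ∃[ a ] (s ~ a × a ∈ W)
  walk-second (stop _)   s≢t = ⊥-elim (s≢t refl)
  walk-second (cons h w) _   = _ , h , there (start∈ w)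

  walk-∈-split : Walk s t W → z ∈ W → z ≢ t → ∃[ A ] ∃[ b ] ∃[ B ] (W ≡ A ++ z ∷ b ∷ B)
  walk-∈-split w z∈ z≢t with ∈-∃++ z∈
  ... | A , []    , refl = ⊥-elim (z≢t (walk-end-unique A w))
  ... | A , b ∷ B , refl = A , b , B , refl

  walk-penultimate : Walk s t W → s ≢ t → ∃[ b ] ∃[ W′ ] (W ≡ W′ ∷ʳ t × Walk s b W′ × b ~ t)
  walk-penultimate (stop _)   s≢t = ⊥-elim (s≢t refl)
  walk-penultimate (cons h w) _   = last-edge h w
    where
      last-edge : x ~ y → Walk y t (y ∷ L) →
        ∃[ b ] ∃[ W′ ] (x ∷ y ∷ L ≡ W′ ∷ʳ t × Walk x b W′ × b ~ t)
      last-edge h (stop _) = _ , _ ∷ [] , refl , stop _ , h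
      last-edge {x} h (cons h′ w) with last-edge h′ w
      ... | b , W′ , eq , wb , hb = b , x ∷ W′ , cong (x ∷_) eq , h ◅ wb , hb

  walk⇒chain : Walk s t W → Chain G W
  walk⇒chain (stop _)   = tt
  walk⇒chain (cons h w) = h , walk⇒chain w

  walk-head : Walk s t W → ∃[ L ] W ≡ s ∷ L
  walk-head (stop _)   = _ , refl
  walk-head (cons _ _) = _ , refl

  walk⇒ends : Walk s t W → Ends G s t W
  walk⇒ends w = walk-head w , ends w
    where
      ends : Walk s t W → ∃[ init ] W ≡ init ++ t ∷ []
      ends (stop _) = [] , refl
      ends {s} (cons _ w) with ends w
      ... | init , eq = s ∷ init , cong (s ∷_) eq

  chain⇒walk : Chain G W → Ends G s t W → Walk s t W
  chain⇒walk c ((L , refl) , (init , eq)) = go L init c eq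
    where
      go : ∀ L init → Chain G (s ∷ L) → s ∷ L ≡ init ∷ʳ t → Walk s t (s ∷ L)
      go []      []              _       refl = stop _
      go []      (_ ∷ [])        _       ()
      go []      (_ ∷ _ ∷ _)     _       ()
      go (_ ∷ L) []              _       ()
      go (_ ∷ L) (_ ∷ init)      (h , c) eq   = cons h (go L init c (∷-injectiveʳ eq))

  -- Toll walks

  OnlyNeighbour : V G → V G → List (V G) → Set
  OnlyNeighbour b t W = ∀ {z} → z ∈ W → t ~ z → z ≡ b

  AtMostOneNeighbour : V G → List (V G) → Set
  AtMostOneNeighbour t W = ∀ {b} → b ∈ W → t ~ b → OnlyNeighbour b t W

  AtMostOneNeighbour-++ˡ : (∀ {z} → z ∈ B → ¬ t ~ z) →
    AtMostOneNeighbour t A → AtMostOneNeighbour t (A ++ B)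
  AtMostOneNeighbour-++ˡ {A = A} far one b∈ hb z∈ hz with ∈-++⁻ A b∈ | ∈-++⁻ A z∈
  ... | inj₁ b∈A | inj₁ z∈A = one b∈A hb z∈A hz
  ... | inj₂ b∈B | _        = ⊥-elim (far b∈B hb)
  ... | _        | inj₂ z∈B = ⊥-elim (far z∈B hz)

  AtMostOneNeighbour-++ʳ : (∀ {z} → z ∈ A → ¬ t ~ z) →
    AtMostOneNeighbour t B → AtMostOneNeighbour t (A ++ B)
  AtMostOneNeighbour-++ʳ {A = A} far one b∈ hb z∈ hz with ∈-++⁻ A b∈ | ∈-++⁻ A z∈
  ... | inj₂ b∈B | inj₂ z∈B = one b∈B hb z∈B hz
  ... | inj₁ b∈A | _        = ⊥-elim (far b∈A hb)
  ... | _        | inj₁ z∈A = ⊥-elim (far z∈A hz)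

  OnlyNeighbour-⊆ : A ⊆ B → OnlyNeighbour b t B → OnlyNeighbour b t A
  OnlyNeighbour-⊆ A⊆B only z∈ h = only (A⊆B z∈) h

  only⇒atMostOne : OnlyNeighbour b t W → AtMostOneNeighbour t W
  only⇒atMostOne only b∈ hb z∈ hz = trans (only z∈ hz) (sym (only b∈ hb))

  AtMostOneNeighbour-∷ : ¬ t ~ x → AtMostOneNeighbour t W → AtMostOneNeighbour t (x ∷ W)
  AtMostOneNeighbour-∷ t≁x one (here refl) hb = ⊥-elim (t≁x hb)
  AtMostOneNeighbour-∷ t≁x one (there b∈) hb (here refl) hz = ⊥-elim (t≁x hz)
  AtMostOneNeighbour-∷ t≁x one (there b∈) hb (there z∈) hz = one b∈ hb z∈ hz

  AtMostOneNeighbour-⊆ : A ⊆ B → AtMostOneNeighbour t B → AtMostOneNeighbour t A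
  AtMostOneNeighbour-⊆ A⊆B one b∈ hb = OnlyNeighbour-⊆ A⊆B (one (A⊆B b∈) hb)

  tollWalk⁻ : TollWalk G u v W →
    u ≢ v × Walk u v W × AtMostOneNeighbour u W × AtMostOneNeighbour v W
  tollWalk⁻ {u} {v} {W} (u≢v , c , (a , rest , eq , only-a) , (b , init , eq′ , only-b)) =
    u≢v
    , chain⇒walk c ((a ∷ rest , eq) , (init ∷ʳ b , trans eq′ (sym (++-assoc init (b ∷ []) (v ∷ [])))))
    , only⇒atMostOne (λ {z} → only-a z) , only⇒atMostOne (λ {z} → only-b z)

  tollWalk⁺ : u ≢ v → Walk u v W → AtMostOneNeighbour u W → AtMostOneNeighbour v W → TollWalk G u v W
  tollWalk⁺ u≢v w@(cons h _) one-u one-v with walk-penultimate w u≢v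
  ... | b , W′ , eq , wb , hb with walk⇒ends wb
  ...   | _ , (init , eq′) =
    u≢v , walk⇒chain w
    , (_ , _ , refl , λ _ z∈ hz → one-u (there (here refl)) h z∈ hz)
    , (b , init , trans eq (trans (cong (_∷ʳ _) eq′) (++-assoc init (b ∷ []) (_ ∷ [])))
      , λ _ z∈ hz → one-v (subst (b ∈_) (sym eq) (∈-++⁺ˡ (end∈ wb))) (~-sym hb) z∈ hz)
  tollWalk⁺ u≢v (stop _) _ _ = ⊥-elim (u≢v refl)

  T-sym : T G u v z → T G v u z
  T-sym (inj₁ (refl , z≡u)) = inj₁ (refl , z≡u)
  T-sym (inj₂ (W , toll , z∈)) with tollWalk⁻ toll
  ... | u≢v , w , one-u , one-v =
    inj₂ (reverse W , tollWalk⁺ (λ eq → u≢v (sym eq)) (walk-reverse w) (reversed one-v) (reversed one-u)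
         , reverse⁺ z∈)
    where
      reversed : AtMostOneNeighbour x W → AtMostOneNeighbour x (reverse W)
      reversed = AtMostOneNeighbour-⊆ reverse⁻

  T-toll : z ≢ u → T G u v z → ∃[ W ] (TollWalk G u v W × z ∈ W)
  T-toll z≢u (inj₁ (_ , z≡u)) = ⊥-elim (z≢u z≡u)
  T-toll _   (inj₂ toll)      = toll

  T-diagonal : T G u u z → z ≡ u
  T-diagonal (inj₁ (_ , z≡u))     = z≡u
  T-diagonal (inj₂ (_ , toll , _)) = ⊥-elim (proj₁ toll refl)

  -- Induced paths

  NoChordFrom : V G → List (V G) → Set
  NoChordFrom x []      = ⊤
  NoChordFrom x (_ ∷ L) = All (λ z → ¬ x ~ z) L

  Induced : List (V G) → Set
  Induced []      = ⊤
  Induced (x ∷ L) = x ∉ L × NoChordFrom x L × Induced L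

  Induced⇒InducedPath : Chain G P → Induced P → InducedPath G P
  Induced⇒InducedPath {P} c ind = unique P ind , c , noChord P ind
    where
      unique : ∀ P → Induced P → Unique P
      unique []      _               = []
      unique (x ∷ L) (x∉ , _ , ind) = ¬Any⇒All¬ L x∉ ∷ unique L ind
      noChord : ∀ P → Induced P →
        ∀ (i j : Fin (length P)) → suc (toℕ i) < toℕ j → ¬ (lookup P i ~ lookup P j)
      noChord (_ ∷ _ ∷ _) (_ , far , _) fzero    (fsuc (fsuc j)) _       = All-lookup far (∈-lookup j)
      noChord (_ ∷ L)     (_ , _ , ind) (fsuc i) (fsuc j)        (s≤s p) = noChord L ind i j p
      noChord (_ ∷ _ ∷ _) _             fzero    (fsuc fzero)    (s≤s ())

  InducedPath⇒Induced : InducedPath G P → Induced P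
  InducedPath⇒Induced {[]}    _                       = tt
  InducedPath⇒Induced {x ∷ L} (x∉ ∷ unique , c , noChord) =
    All¬⇒¬Any x∉ , noChordFrom L (λ j → noChord fzero (fsuc j))
    , InducedPath⇒Induced (unique , tail-chain L c , λ i j p → noChord (fsuc i) (fsuc j) (s≤s p))
    where
      tail-chain : ∀ L → Chain G (x ∷ L) → Chain G L
      tail-chain []      _       = tt
      tail-chain (_ ∷ _) (_ , c) = c
      noChordFrom : ∀ L → (∀ j → 1 < suc (toℕ j) → ¬ x ~ lookup L j) → NoChordFrom x L
      noChordFrom []      _       = tt
      noChordFrom (_ ∷ _) noChord =
        tabulate λ z∈ h → noChord (fsuc (index z∈)) (s≤s (s≤s z≤n)) (subst (x ~_) (lookup-index z∈) h)

  induced-suffix : ∀ A → Induced (A ++ B) → Induced B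
  induced-suffix []      ind           = ind
  induced-suffix (_ ∷ A) (_ , _ , ind) = induced-suffix A ind

  induced-prefix : ∀ A → Induced (A ++ B) → Induced A
  induced-prefix []          _ = tt
  induced-prefix {B = B} (x ∷ A) (x∉ , noChord , ind) =
    (λ x∈ → x∉ (∈-++⁺ˡ x∈)) , noChordFrom A noChord , induced-prefix A ind
    where
      noChordFrom : ∀ A → NoChordFrom x (A ++ B) → NoChordFrom x A
      noChordFrom []      _       = tt
      noChordFrom (_ ∷ A) noChord = ++⁻ˡ A noChord

  induced-proper-prefix : ∀ A → Walk s t (A ++ z ∷ b ∷ B) → Induced (A ++ z ∷ b ∷ B) →
    Walk s z (A ∷ʳ z) × Induced (A ∷ʳ z) × length (A ∷ʳ z) < length (A ++ z ∷ b ∷ B)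
  induced-proper-prefix {z = z} {b = b} {B = B} A w ind =
    walk-prefix A w , induced-prefix (A ∷ʳ z) (subst Induced (sym (++-assoc A (z ∷ []) (b ∷ B))) ind) , shorter A
    where
      shorter : ∀ A → length (A ∷ʳ z) < length (A ++ z ∷ b ∷ B)
      shorter []      = s≤s (s≤s z≤n)
      shorter (_ ∷ A) = s≤s (shorter A)

  last-neighbour : ∀ L → Any (s ~_) L →
    ∃[ A ] ∃[ r ] ∃[ B ] (L ≡ A ++ r ∷ B × s ~ r × All (λ z → ¬ s ~ z) B)
  last-neighbour {s} (z ∷ L) any with any? (~-dec s) L
  ... | yes later with last-neighbour L later
  ...   | A , r , B , eq , h , far = z ∷ A , r , B , cong (z ∷_) eq , h , far
  last-neighbour (z ∷ L) (here h)  | no none = [] , z , L , refl , h , ¬Any⇒All¬ L none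
  last-neighbour (z ∷ L) (there p) | no none = ⊥-elim (none p)

  induced-subpath : Walk s t W → ∃[ P ] (Walk s t P × Induced P × P ⊆ W × length P ≤ length W)
  induced-subpath (stop x) = x ∷ [] , stop x , ((λ ()) , tt , tt) , (λ p → p) , ≤-refl
  induced-subpath {s} (cons {y = y} {L = L} h w) with induced-subpath w
  ... | P , wP , ind , P⊆ , P≤ with any? (s ≟_) P
  ...   | yes s∈ with ∈-∃++ s∈
  ...     | A , B , refl =
    s ∷ B , walk-suffix A wP , induced-suffix A ind , (λ q → there (P⊆ (∈-++⁺ʳ A q)))
    , ≤-trans (length-++-≤ʳ (s ∷ B) {A}) (≤-trans P≤ (n≤1+n _))
  induced-subpath {s} (cons {y = y} {L = L} h w) | P , wP , ind , P⊆ , P≤ | no s∉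
    with last-neighbour P (lose (start∈ wP) h)
  ... | A , r , B , refl , hr , far =
    s ∷ r ∷ B , cons hr (walk-suffix A wP) , (s∉′ , far , induced-suffix A ind) , ⊆W
    , s≤s (≤-trans (length-++-≤ʳ (r ∷ B) {A}) P≤)
    where
      s∉′ : s ∉ r ∷ B
      s∉′ q = s∉ (∈-++⁺ʳ A q)
      ⊆W : s ∷ r ∷ B ⊆ s ∷ y ∷ L
      ⊆W (here eq) = here eq
      ⊆W (there q) = there (P⊆ (∈-++⁺ʳ A q))

  induced-start : Walk s t P → Induced P → AtMostOneNeighbour s P
  induced-start (stop _)            _              (here refl) hb = ⊥-elim (~-irr hb)
  induced-start {s} (cons {y = y} {L = L} _ _) (_ , far , _) = only⇒atMostOne only-y
    where
      only-y : OnlyNeighbour y s (s ∷ y ∷ L)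
      only-y (here refl)         h = ⊥-elim (~-irr h)
      only-y (there (here refl)) _ = refl
      only-y (there (there z∈))  h = ⊥-elim (All-lookup far z∈ h)

  induced-end : Walk s t P → Induced P → AtMostOneNeighbour t P
  induced-end (stop _)                _             (here refl) hb = ⊥-elim (~-irr hb)
  induced-end {t = t} (cons {x = x} _ (stop _)) _ = only⇒atMostOne only-x
    where
      only-x : OnlyNeighbour x t (x ∷ t ∷ [])
      only-x (here refl)         _ = refl
      only-x (there (here refl)) h = ⊥-elim (~-irr h)
  induced-end (cons _ (cons h w))     (_ , far , ind) =
    AtMostOneNeighbour-∷ (λ h′ → All-lookup far (end∈ w) (~-sym h′)) (induced-end (cons h w) ind)

  induced⇒toll : s ≢ t → Walk s t P → Induced P → TollWalk G s t P
  induced⇒toll s≢t w ind = tollWalk⁺ s≢t w (induced-start w ind) (induced-end w ind)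

  InducedWalk : V G → V G → List (V G) → Set
  InducedWalk s t P = Walk s t P × Induced P

  T-induced : s ≢ t → InducedWalk s t P → z ∈ P → T G s t z
  T-induced s≢t (w , ind) z∈ = inj₂ (_ , induced⇒toll s≢t w ind , z∈)

  induced-P₂ : x ~ y → InducedWalk x y (x ∷ y ∷ [])
  induced-P₂ h = cons h (stop _) , (λ { (here refl) → ~-irr h }) , [] , (λ ()) , tt , tt

  induced-P₃ : a ~ b → b ~ c → a ≢ c → ¬ a ~ c → InducedWalk a c (a ∷ b ∷ c ∷ [])
  induced-P₃ ab bc a≢c a≁c = cons ab (proj₁ (induced-P₂ bc))
    , (λ { (here refl) → ~-irr ab ; (there (here refl)) → a≢c refl }) , a≁c ∷ [] , proj₂ (induced-P₂ bc)

  induced-P₄ : a ~ b → b ~ c → c ~ d → a ≢ c → a ≢ d → b ≢ d → ¬ a ~ c → ¬ a ~ d → ¬ b ~ d →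
    InducedWalk a d (a ∷ b ∷ c ∷ d ∷ [])
  induced-P₄ ab bc cd a≢c a≢d b≢d a≁c a≁d b≁d with induced-P₃ bc cd b≢d b≁d
  ... | w , ind = cons ab w
    , (λ { (here refl) → ~-irr ab ; (there (here refl)) → a≢c refl ; (there (there (here refl))) → a≢d refl })
    , a≁c ∷ a≁d ∷ [] , ind

  -- The transit function on edges

  walk-invariant : (S : V G → Set) → (∀ {a b} → S a → a ~ b → b ∈ W → S b) →
    Walk s t L → L ⊆ W → S s → All S L
  walk-invariant S step (stop _)   _  Ss = Ss ∷ []
  walk-invariant S step (cons h w) L⊆ Ss =
    Ss ∷ walk-invariant S step w (λ q → L⊆ (there q)) (step Ss h (L⊆ (there (start∈ w))))

  -- On a toll walk between adjacent u and v, the only neighbour of u is v and vice versa.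
  T-edge : u ~ v → T G u v z → z ≡ u ⊎ z ≡ v
  T-edge _ (inj₁ (_ , z≡u)) = inj₁ z≡u
  T-edge {u} {v} huv (inj₂ (W , toll , z∈)) with tollWalk⁻ toll
  ... | _ , w , one-u , one-v =
    All-lookup (walk-invariant (λ a → a ≡ u ⊎ a ≡ v) step w (λ q → q) (inj₁ refl)) z∈
    where
      step : a ≡ u ⊎ a ≡ v → a ~ b → b ∈ W → b ≡ u ⊎ b ≡ v
      step (inj₁ refl) h b∈ = inj₂ (one-u (end∈ w) huv b∈ h)
      step (inj₂ refl) h b∈ = inj₁ (one-v (start∈ w) (~-sym huv) b∈ h)

  interior⇒≁ : T G u v z → z ≢ u → z ≢ v → ¬ u ~ v
  interior⇒≁ Tz z≢u z≢v huv with T-edge huv Tz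
  ... | inj₁ z≡u = z≢u z≡u
  ... | inj₂ z≡v = z≢v z≡v

  adjacent⇒IsPair : u ~ v → IsPair G u v
  adjacent⇒IsPair h z = T-edge h , λ
    { (inj₁ refl) → T-induced (~⇒≢ h) (induced-P₂ h) (here refl)
    ; (inj₂ refl) → T-induced (~⇒≢ h) (induced-P₂ h) (there (here refl)) }

  IsPair⇒adjacent : IsPair G u v → u ≢ v → u ~ v
  IsPair⇒adjacent {u} {v} pair u≢v with proj₂ (pair v) (inj₂ refl)
  ... | inj₁ (u≡v , _) = ⊥-elim (u≢v u≡v)
  ... | inj₂ (W , toll , _) with tollWalk⁻ toll
  ...   | _ , stop _ , _ = ⊥-elim (u≢v refl)
  ...   | _ , cons {y = a} h w , _ with proj₁ (pair a) (inj₂ (W , toll , there (here refl)))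
  ...     | inj₁ refl = ⊥-elim (~-irr h)
  ...     | inj₂ refl = h

  IsPair-refl : IsPair G u u
  IsPair-refl z = (λ Tz → inj₁ (T-diagonal Tz))
    , λ { (inj₁ z≡u) → inj₁ (refl , z≡u) ; (inj₂ z≡u) → inj₁ (refl , z≡u) }

  ¬IsPair⇒≢ : ¬ IsPair G u v → u ≢ v
  ¬IsPair⇒≢ ¬pair refl = ¬pair IsPair-refl

  ¬IsPair⇒≁ : ¬ IsPair G u v → ¬ u ~ v
  ¬IsPair⇒≁ ¬pair h = ¬pair (adjacent⇒IsPair h)

  ≁⇒¬IsPair : u ≢ v → ¬ u ~ v → ¬ IsPair G u v
  ≁⇒¬IsPair u≢v u≁v pair = u≁v (IsPair⇒adjacent pair u≢v)

  short-walk : Walk s t W → length W ≤ 2 → s ≡ t ⊎ s ~ t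
  short-walk (stop _)                   _ = inj₁ refl
  short-walk (cons h (stop _))          _ = inj₂ h
  short-walk (cons _ (cons _ (stop _))) (s≤s (s≤s ()))
  short-walk (cons _ (cons _ (cons _ _))) (s≤s (s≤s ()))

  -- Distance-hereditary graphs satisfy (dh) and (dh1)

  module _ (dh : DistanceHereditary G) where

    geodesic : Walk s t P → Induced P → Walk s t Q → length P ≤ length Q
    geodesic wP ind wQ =
      dh _ _ _ (Induced⇒InducedPath (walk⇒chain wP) ind) (walk⇒ends wP) _ (walk⇒chain wQ) (walk⇒ends wQ)

    geodesic-penultimate : Walk s t W → s ≢ t →
      ∃[ b ] ∃[ P ] (b ∈ W × b ~ t × Walk s b P × ∀ {Q} → Walk s t Q → length P < length Q)
    geodesic-penultimate w s≢t with induced-subpath w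
    ... | _ , wP , ind , P⊆ , _ with walk-penultimate wP s≢t
    ...   | b , P , refl , wb , hb =
      b , P , P⊆ (∈-++⁺ˡ (end∈ wb)) , hb , wb , λ wQ → subst (_≤ _) (length-∷ʳ P) (geodesic wP ind wQ)

    only-neighbour-adjacent : Walk s t W → OnlyNeighbour b t W → s ≢ t → s ≢ b → s ~ z → z ~ t → s ~ b
    only-neighbour-adjacent w only s≢t s≢b sz zt with geodesic-penultimate w s≢t
    ... | b′ , P , b′∈ , hb′ , wb′ , shortest with only b′∈ (~-sym hb′)
    ...   | refl with short-walk wb′ (s≤s⁻¹ (shortest (cons sz (cons zt (stop _)))))
    ...     | inj₁ s≡b = ⊥-elim (s≢b s≡b)
    ...     | inj₂ sb  = sb

    -- Otherwise geodesics from u would reach y through x and x through y.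
    opposite-side-nonadjacent : x ~ y → ¬ u ~ x → u ≢ x → u ≢ y →
      Walk u y A → OnlyNeighbour x y A → Walk x w B → OnlyNeighbour y x B → ¬ u ~ w
    opposite-side-nonadjacent {B = B} xy u≁x u≢x u≢y wA onlyA wB onlyB uw
      with geodesic-penultimate wA u≢y | geodesic-penultimate (uw ◅ walk-reverse wB) u≢x
    ... | b , PA , b∈ , hb , wPA , shortestA | b′ , PB , b′∈ , hb′ , wPB , shortestB
      with onlyA b∈ (~-sym hb) | b′∈
    ...   | refl | here refl = u≁x hb′
    ...   | refl | there b′∈B with onlyB (reverse⁻ b′∈B) (~-sym hb′)
    ...     | refl = <-asym (shortestA wPB) (shortestB wPA)

    DH⇒AxiomDH : AxiomDH G
    DH⇒AxiomDH u x y v z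
      ( (u≢x ∷ u≢y ∷ u≢v ∷ u≢z ∷ []) ∷ (x≢y ∷ x≢v ∷ x≢z ∷ [])
      ∷ (y≢v ∷ y≢z ∷ []) ∷ (v≢z ∷ []) ∷ [] ∷ [])
      (x∈uy , _) (_ , y∈xv) _ ¬uv xy uz vz (xz , yz)
      with T-toll (≢-sym u≢x) x∈uy | T-toll (≢-sym x≢y) y∈xv
    ... | W₁ , toll₁ , x∈W₁ | W₂ , toll₂ , y∈W₂ with tollWalk⁻ toll₁ | tollWalk⁻ toll₂
    ...   | _ , w₁ , _ , one-y | _ , w₂ , one-x , _ =
      <-irrefl refl (geodesic (proj₁ uxyv) (proj₂ uxyv) (cons huz (cons (~-sym hvz) (stop v))))
      where
        hxy : x ~ y
        hxy = IsPair⇒adjacent xy x≢y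
        huz : u ~ z
        huz = IsPair⇒adjacent uz u≢z
        hvz : v ~ z
        hvz = IsPair⇒adjacent vz v≢z
        hux : u ~ x
        hux = only-neighbour-adjacent w₁ (one-y x∈W₁ (~-sym hxy)) u≢y u≢x huz
                (~-sym (IsPair⇒adjacent yz y≢z))
        hvy : v ~ y
        hvy = only-neighbour-adjacent (walk-reverse w₂) (OnlyNeighbour-⊆ reverse⁻ (one-x y∈W₂ hxy))
                (≢-sym x≢v) (≢-sym y≢v) hvz (~-sym (IsPair⇒adjacent xz x≢z))
        uxyv : InducedWalk u v (u ∷ x ∷ y ∷ v ∷ [])
        uxyv = induced-P₄ hux hxy (~-sym hvy) u≢y u≢v x≢v
                 (interior⇒≁ x∈uy (≢-sym u≢x) x≢y) (¬IsPair⇒≁ ¬uv)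
                 (interior⇒≁ y∈xv (≢-sym x≢y) y≢v)

    DH⇒AxiomDH1 : AxiomDH1 G
    DH⇒AxiomDH1 u x y v x∈uy y∈xv xy x≢y ¬ux ¬yv
      with T-toll (≢-sym (¬IsPair⇒≢ ¬ux)) x∈uy | T-toll (≢-sym x≢y) y∈xv
    ... | W₁ , toll₁ , x∈W₁ | W₂ , toll₂ , y∈W₂ with tollWalk⁻ toll₁ | tollWalk⁻ toll₂
    ...   | u≢y , w₁ , one-u , one-y | x≢v , w₂ , one-x , one-v
      with walk-penultimate w₁ u≢y | walk-head w₂
    ...     | b , W , refl , wb , hb | B , refl
      with one-y x∈W₁ (~-sym (IsPair⇒adjacent xy x≢y)) (∈-++⁺ˡ (end∈ wb)) (~-sym hb)
    ...       | refl = inj₂ (W ++ B , tollWalk⁺ u≢v (wb ⊙ w₂) one-u′ one-v′ , ∈-++⁺ˡ (end∈ wb))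
      where
        hxy : x ~ y
        hxy = IsPair⇒adjacent xy x≢y
        u≢x : u ≢ x
        u≢x = ¬IsPair⇒≢ ¬ux
        y≢v : y ≢ v
        y≢v = ¬IsPair⇒≢ ¬yv
        u-far : ∀ {z} → z ∈ x ∷ B → ¬ u ~ z
        u-far z∈ with walk-to z∈ w₂
        ... | _ , wz , ⊆W₂ =
          opposite-side-nonadjacent hxy (¬IsPair⇒≁ ¬ux) u≢x u≢y w₁ (one-y x∈W₁ (~-sym hxy))
            wz (OnlyNeighbour-⊆ ⊆W₂ (one-x y∈W₂ hxy))
        v-far : ∀ {z} → z ∈ W ∷ʳ y → ¬ v ~ z
        v-far z∈ with walk-to (reverse⁺ z∈) (walk-reverse w₁)
        ... | _ , wz , ⊆W₁ =
          opposite-side-nonadjacent (~-sym hxy) (λ vy → ¬IsPair⇒≁ ¬yv (~-sym vy))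
            (≢-sym y≢v) (≢-sym x≢v)
            (walk-reverse w₂) (OnlyNeighbour-⊆ reverse⁻ (one-x y∈W₂ hxy))
            wz (OnlyNeighbour-⊆ (λ q → reverse⁻ (⊆W₁ q)) (one-y x∈W₁ (~-sym hxy)))
        u≢v : u ≢ v
        u≢v refl with walk-second w₁ u≢y
        ... | _ , ha , a∈ = v-far a∈ ha
        one-u′ : AtMostOneNeighbour u (W ++ B)
        one-u′ = AtMostOneNeighbour-++ˡ (λ z∈ → u-far (there z∈)) (AtMostOneNeighbour-⊆ ∈-++⁺ˡ one-u)
        one-v′ : AtMostOneNeighbour v (W ++ B)
        one-v′ = AtMostOneNeighbour-++ʳ (λ z∈ → v-far (∈-++⁺ˡ z∈)) (AtMostOneNeighbour-⊆ there one-v)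

  -- (dh1) with u = v = s would put x into T(s,s) = {s}.
  no-crossing-edge : AxiomDH1 G → x ~ y → T G s y x → T G x s y →
    s ≢ x → s ≢ y → ¬ s ~ x → ¬ s ~ y → ⊥
  no-crossing-edge {x} {y} {s} ax1 xy x∈sy y∈xs s≢x s≢y s≁x s≁y =
    s≢x (sym (T-diagonal (ax1 s x y s x∈sy y∈xs (adjacent⇒IsPair xy) (~⇒≢ xy)
      (≁⇒¬IsPair s≢x s≁x) (≁⇒¬IsPair (≢-sym s≢y) (λ ys → s≁y (~-sym ys))))))

  -- Otherwise y s w t is an induced path and no-crossing-edge applies to the edge y s.
  P₄-ends-common-neighbour : AxiomDH1 G →
    Walk t s (t ∷ x ∷ y ∷ s ∷ []) → Induced (t ∷ x ∷ y ∷ s ∷ []) → w ~ t → w ~ s → w ~ y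
  P₄-ends-common-neighbour {t} {s} {x} {y} {w} ax1 txys@(cons _ (cons _ (cons ys (stop _))))
    ind@(t∉ , t≁y ∷ t≁s ∷ [] , _) wt ws =
    decidable-stable (~-dec _ _) λ w≁y →
      no-crossing-edge ax1 ys (T-induced t≢s (txys , ind) (there (there (here refl))))
        (T-induced (≢-sym t≢y) (ystw w≁y) (there (here refl))) t≢y t≢s t≁y t≁s
    where
      t≢y : t ≢ y
      t≢y = ∉⇒≢ t∉ (there (here refl))
      t≢s : t ≢ s
      t≢s = ∉⇒≢ t∉ (there (there (here refl)))
      ystw : ¬ w ~ y → InducedWalk y t (y ∷ s ∷ w ∷ t ∷ [])
      ystw w≁y = induced-P₄ ys (~-sym ws) wt (λ { refl → t≁y (~-sym wt) }) (≢-sym t≢y) (≢-sym t≢s)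
                   (λ yw → w≁y (~-sym yw)) (λ yt → t≁y (~-sym yt)) (λ st → t≁s (~-sym st))

  no-gem : AxiomDH G → Walk t s (t ∷ x ∷ y ∷ s ∷ []) → Induced (t ∷ x ∷ y ∷ s ∷ []) →
    w ~ t → w ~ x → w ~ y → w ~ s → ⊥
  no-gem {t} {s} {x} {y} {w} ax (cons tx (cons xy (cons ys (stop _))))
    (t∉ , t≁y ∷ t≁s ∷ [] , x∉ , x≁s ∷ [] , _) wt wx wy ws =
    ax t x y s w distinct
      (T-induced t≢y txy (there (here refl)) , T-induced x≢s xys (here refl))
      (T-induced t≢y txy (there (there (here refl))) , T-induced x≢s xys (there (here refl)))
      (T-induced t≢y twy (there (here refl)) , T-induced x≢s xws (there (here refl)))
      (≁⇒¬IsPair t≢s t≁s) (adjacent⇒IsPair xy) (adjacent⇒IsPair (~-sym wt)) (adjacent⇒IsPair (~-sym ws))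
      (adjacent⇒IsPair (~-sym wx) , adjacent⇒IsPair (~-sym wy))
    where
      t≢y : t ≢ y
      t≢y = ∉⇒≢ t∉ (there (here refl))
      t≢s : t ≢ s
      t≢s = ∉⇒≢ t∉ (there (there (here refl)))
      x≢s : x ≢ s
      x≢s = ∉⇒≢ x∉ (there (here refl))
      txy : InducedWalk t y (t ∷ x ∷ y ∷ [])
      txy = induced-P₃ tx xy t≢y t≁y
      twy : InducedWalk t y (t ∷ w ∷ y ∷ [])
      twy = induced-P₃ (~-sym wt) wy t≢y t≁y
      xys : InducedWalk x s (x ∷ y ∷ s ∷ [])
      xys = induced-P₃ xy ys x≢s x≁s
      xws : InducedWalk x s (x ∷ w ∷ s ∷ [])
      xws = induced-P₃ (~-sym wx) ws x≢s x≁s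
      distinct : Unique (t ∷ x ∷ y ∷ s ∷ w ∷ [])
      distinct = (~⇒≢ tx ∷ t≢y ∷ t≢s ∷ ≢-sym (~⇒≢ wt) ∷ [])
               ∷ (~⇒≢ xy ∷ x≢s ∷ ≢-sym (~⇒≢ wx) ∷ [])
               ∷ (~⇒≢ ys ∷ ≢-sym (~⇒≢ wy) ∷ [])
               ∷ (≢-sym (~⇒≢ ws) ∷ [])
               ∷ [] ∷ []

  -- (dh) and (dh1) force distance-heredity

  ShortestBelow : ℕ → Set
  ShortestBelow k = ∀ {t s P Q} → Walk t s P → Induced P → Walk t s Q →
    length P + length Q < k → length P ≤ length Q

  module _ (ax : AxiomDH G) (ax1 : AxiomDH1 G) where

    P₄-with-apex-impossible : Walk t s (t ∷ x ∷ y ∷ r ∷ P) → Induced (t ∷ x ∷ y ∷ r ∷ P) →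
      P ≡ [] → t ~ w → w ~ x → w ~ s → ⊥
    P₄-with-apex-impossible txys@(cons _ (cons _ (cons _ (stop _)))) ind refl tw wx ws =
      no-gem ax txys ind (~-sym tw) wx (P₄-ends-common-neighbour ax1 txys ind (~-sym tw) ws) ws

    module MinimalCounterexample {t x y r s w q : V G} {P₂ Q₁ : List (V G)}
      (wP : Walk t s (t ∷ x ∷ y ∷ r ∷ P₂)) (indP : Induced (t ∷ x ∷ y ∷ r ∷ P₂))
      (wQ : Walk t s (t ∷ w ∷ q ∷ Q₁)) (indQ : Induced (t ∷ w ∷ q ∷ Q₁))
      (Q<P : length (t ∷ w ∷ q ∷ Q₁) < length (t ∷ x ∷ y ∷ r ∷ P₂))
      (ih : ShortestBelow (length (t ∷ x ∷ y ∷ r ∷ P₂) + length (t ∷ w ∷ q ∷ Q₁))) where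

      private
        ∣P∣ ∣Q∣ : ℕ
        ∣P∣ = length (t ∷ x ∷ y ∷ r ∷ P₂)
        ∣Q∣ = length (t ∷ w ∷ q ∷ Q₁)
        P≰Q : ¬ ∣P∣ ≤ ∣Q∣
        P≰Q = <⇒≱ Q<P
        wX : Walk x s (x ∷ y ∷ r ∷ P₂)
        wX = walk-tail wP
        wY : Walk y s (y ∷ r ∷ P₂)
        wY = walk-tail wX
        wR : Walk r s (r ∷ P₂)
        wR = walk-tail wY
        wW : Walk w s (w ∷ q ∷ Q₁)
        wW = walk-tail wQ
        indX : Induced (x ∷ y ∷ r ∷ P₂)
        indX = proj₂ (proj₂ indP)
        indY : Induced (y ∷ r ∷ P₂)
        indY = proj₂ (proj₂ indX)
        t-far : All (λ z → ¬ t ~ z) (y ∷ r ∷ P₂)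
        t-far = proj₁ (proj₂ indP)
        s∈R : s ∈ r ∷ P₂
        s∈R = end∈ wR
        t≢s : t ≢ s
        t≢s = ∉⇒≢ (proj₁ indP) (there (there s∈R))
        x≢s : x ≢ s
        x≢s = ∉⇒≢ (proj₁ indX) (there s∈R)
        x≁s : ¬ x ~ s
        x≁s = All-lookup (proj₁ (proj₂ indX)) s∈R
        three≤Q : 3 ≤ ∣Q∣
        three≤Q = s≤s (s≤s (s≤s z≤n))
        shorter-path : Walk a b P → Induced P → Walk a b Q →
          length P < ∣P∣ → length Q ≤ ∣Q∣ → length P ≤ length Q
        shorter-path {P = P} {Q = Q} wP′ indP′ wQ′ p q =
          ih wP′ indP′ wQ′ (+-mono-<-≤ {length P} {_} {length Q} p q)
        shorter-walk : Walk a b P → Induced P → Walk a b Q →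
          length P ≤ ∣P∣ → length Q < ∣Q∣ → length P ≤ length Q
        shorter-walk {P = P} {Q = Q} wP′ indP′ wQ′ p q =
          ih wP′ indP′ wQ′ (+-mono-≤-< {length P} {_} {length Q} p q)

      x-far-from-Q : z ∈ q ∷ Q₁ → ¬ x ~ z
      x-far-from-Q z∈ xz with walk-from z∈ (walk-tail wW)
      ... | W , wz , W≤ = P≰Q (s≤s (≤-trans X≤ (s≤s W≤)))
        where
          X≤ : length (x ∷ y ∷ r ∷ P₂) ≤ length (x ∷ W)
          X≤ = shorter-path wX indX (xz ◅ wz) ≤-refl (s≤s (≤-trans W≤ (n≤1+n _)))

      -- Otherwise x t w q ⋯ s is a toll walk from x to s, and the edge x t crosses with respect to s.
      w~x : w ~ x
      w~x = decidable-stable (~-dec w x) λ w≁x →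
        no-crossing-edge ax1 (~-sym (walk-edge wP)) (T-sym (T-induced t≢s (wP , indP) (there (here refl))))
          (inj₂ (_ , tollWalk⁺ x≢s (~-sym (walk-edge wP) ◅ wQ) (only⇒atMostOne (only-t w≁x))
                       (AtMostOneNeighbour-∷ (λ sx → x≁s (~-sym sx)) (induced-end wQ indQ))
                 , there (here refl)))
          (≢-sym x≢s) (≢-sym t≢s) (λ sx → x≁s (~-sym sx))
          (λ st → All-lookup t-far (there s∈R) (~-sym st))
        where
          only-t : ¬ w ~ x → OnlyNeighbour t x (x ∷ t ∷ w ∷ q ∷ Q₁)
          only-t _   (here refl)                 xx = ⊥-elim (~-irr xx)
          only-t _   (there (here refl))         _  = refl
          only-t w≁x (there (there (here refl))) xw = ⊥-elim (w≁x (~-sym xw))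
          only-t _   (there (there (there z∈)))  xz = ⊥-elim (x-far-from-Q z∈ xz)

      -- The prefix of P up to z has at least four vertices, while t w z has three.
      w-far-from-interior : z ∈ r ∷ P₂ → z ≢ s → ¬ w ~ z
      w-far-from-interior {z} z∈ z≢s wz with walk-∈-split wR z∈ z≢s
      ... | A , b , B , eq
        with induced-proper-prefix (t ∷ x ∷ y ∷ A) (subst (λ L → Walk t s (t ∷ x ∷ y ∷ L)) eq wP)
                                                  (subst (λ L → Induced (t ∷ x ∷ y ∷ L)) eq indP)
      ...   | wPre , indPre , Pre< =
        n≮0 (subst (_≤ 0) (length-∷ʳ A) (s≤s⁻¹ (s≤s⁻¹ (s≤s⁻¹ Pre≤))))
        where
          Pre<P : length (t ∷ x ∷ y ∷ A ∷ʳ z) < ∣P∣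
          Pre<P = subst (λ L → length (t ∷ x ∷ y ∷ A ∷ʳ z) < length (t ∷ x ∷ y ∷ L)) (sym eq) Pre<
          Pre≤ : length (t ∷ x ∷ y ∷ A ∷ʳ z) ≤ 3
          Pre≤ = shorter-path wPre indPre (cons (walk-edge wQ) (cons wz (stop z))) Pre<P three≤Q

      -- Otherwise w x y r ⋯ s, or w y r ⋯ s if w ~ y, is an induced path beaten by w q ⋯ s.
      w~s : w ~ s
      w~s = decidable-stable (~-dec w s) λ w≁s → P≰Q (P≤Q w≁s (~-dec w y))
        where
          w∉X : w ∉ x ∷ y ∷ r ∷ P₂
          w∉X (here refl) = ~-irr w~x
          w∉X (there w∈)  = All-lookup t-far w∈ (walk-edge wQ)
          w-far-from-R : ¬ w ~ s → All (λ z → ¬ w ~ z) (r ∷ P₂)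
          w-far-from-R w≁s = tabulate λ {z} z∈ → case z ≟ s of λ
            { (yes refl) → w≁s ; (no z≢s) → w-far-from-interior z∈ z≢s }
          P≤Q : ¬ w ~ s → Dec (w ~ y) → ∣P∣ ≤ ∣Q∣
          P≤Q w≁s (yes wy) =
            s≤s (shorter-path (cons wy wY) ((λ w∈ → w∉X (there w∈)) , w-far-from-R w≁s , indY) wW
                   ≤-refl (n≤1+n _))
          P≤Q w≁s (no w≁y) =
            ≤-trans (shorter-walk (cons w~x wX) (w∉X , w≁y ∷ w-far-from-R w≁s , indX) wW ≤-refl ≤-refl)
                    (n≤1+n _)

      P₂≡[] : P₂ ≡ []
      P₂≡[] = empty (s≤s⁻¹ (s≤s⁻¹ (s≤s⁻¹ X≤)))
        where
          X≤ : length (x ∷ y ∷ r ∷ P₂) ≤ 3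
          X≤ = shorter-path wX indX (cons (~-sym w~x) (cons w~s (stop s))) ≤-refl three≤Q
          empty : ∀ {L : List (V G)} → length L ≤ 0 → L ≡ []
          empty {[]} _ = refl

      impossible : ⊥
      impossible = P₄-with-apex-impossible wP indP P₂≡[] (walk-edge wQ) w~x w~s

    no-shorter-induced-walk : ShortestBelow (length P + length Q) →
      Walk t s P → Induced P → Walk t s Q → Induced Q → length Q < length P → ⊥
    no-shorter-induced-walk _ (stop _) _ (stop _)   _ (s≤s ())
    no-shorter-induced-walk _ (stop _) _ (cons _ _) _ (s≤s ())
    no-shorter-induced-walk _ (cons _ wX) (t∉ , _) (stop _) _ _ = t∉ (end∈ wX)
    no-shorter-induced-walk _ (cons _ (stop _)) _ (cons _ _) _ (s≤s (s≤s ()))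
    no-shorter-induced-walk _ (cons _ (cons _ wY)) (_ , t-far , _) (cons ts (stop _)) _ _ =
      All-lookup t-far (end∈ wY) ts
    no-shorter-induced-walk _ (cons _ (cons _ (stop _))) _ (cons _ (cons _ _)) _ (s≤s (s≤s (s≤s ())))
    no-shorter-induced-walk ih wP@(cons _ (cons _ (cons _ _))) indP wQ@(cons _ (cons _ _)) indQ Q<P =
      MinimalCounterexample.impossible wP indP wQ indQ Q<P ih

    shortest-below : ∀ k → ShortestBelow k
    shortest-below zero _ _ _ ()
    shortest-below (suc k) {P = P} wP indP wQ (s≤s bound) with induced-subpath wQ
    ... | Q′ , wQ′ , indQ′ , _ , Q′≤Q with length P ≤? length Q′
    ...   | yes P≤Q′ = ≤-trans P≤Q′ Q′≤Q
    ...   | no P≰Q′ = ⊥-elim (no-shorter-induced-walk ih wP indP wQ′ indQ′ (≰⇒> P≰Q′))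
      where
        ih : ShortestBelow (length P + length Q′)
        ih wP″ indP″ wQ″ lt =
          shortest-below k wP″ indP″ wQ″ (<-≤-trans lt (≤-trans (+-monoʳ-≤ (length P) Q′≤Q) bound))

    axioms⇒DH : DistanceHereditary G
    axioms⇒DH _ _ P ip eP Q cQ eQ =
      shortest-below (suc (length P + length Q)) (chain⇒walk (proj₁ (proj₂ ip)) eP) (InducedPath⇒Induced ip)
        (chain⇒walk cQ eQ) ≤-refl

theorem13 : ∀ {n : ℕ} (G : Graph n) →
    ((AxiomDH G × AxiomDH1 G) ⇔ DistanceHereditary G)
theorem13 G = mk⇔ (λ (ax , ax1) → axioms⇒DH G ax ax1) (λ dh → DH⇒AxiomDH G dh , DH⇒AxiomDH1 G dh)
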